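{- For any positive integers $x,y,z$ with $x<y\le z$ we have $f(x,y)\le f(x,z)$.
   Context: For integers $1\le x<y$, $f(x,y)$ denotes the unique positive integer $f$ for which there is an odd positive integer $q$ with $(q-1)\cdot 2^{f-1}<x\le q\cdot 2^{f-1}<y\le (q+1)\cdot 2^{f-1}$ (such $f$ and $q$ exist and are unique); that $q$ is denoted $q(x,y)$. -}

module Defs where

open import Data.Nat using (ℕ; suc; _+_; _*_; _∸_; _^_; _≤_; _<_)
open import Data.Product using (Σ; _×_)
open import Relation.Binary.PropositionalEquality using (_≡_)

Odd : ℕ → Set
Odd q = Σ ℕ (λ k → q ≡ suc (2 * k))

IsQF : ℕ → ℕ → ℕ → ℕ → Set
IsQF x y q f =
  1 ≤ f × Odd q ×
  ((q ∸ 1) * 2 ^ (f ∸ 1) < x) × (x ≤ q * 2 ^ (f ∸ 1)) ×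
  (q * 2 ^ (f ∸ 1) < y) × (y ≤ (q + 1) * 2 ^ (f ∸ 1))

-- IsF x y f : f = f(x,y), i.e. f is the (unique) positive integer for which
-- some odd positive q satisfies the inequalities above.
IsF : ℕ → ℕ → ℕ → Set
IsF x y f = Σ ℕ (λ q → IsQF x y q f)

-- Write f₁ = f(x,y) and f₂ = f(x,z). If f₂ < f₁, then q(x,y)·2^(f₁-1) is an even multiple of
-- 2^(f₂-1), and it lies strictly between (q₂-1)·2^(f₂-1) and (q₂+1)·2^(f₂-1) with q₂ = q(x,z),
-- since x ≤ q(x,y)·2^(f₁-1) < y ≤ z. The only multiple of 2^(f₂-1) in that open interval is
-- the odd one q₂·2^(f₂-1), a contradiction.
module Submission where

open import Defs
open import Data.Nat using (ℕ; zero; suc; _+_; _*_; _∸_; _^_; _≤_; _<_; z≤n; s≤s; _≤?_)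
open import Data.Nat.Properties
open import Data.Nat.Tactic.RingSolver using (solve-∀)
open import Data.Product using (_,_)
open import Relation.Nullary using (yes; no)
open import Relation.Nullary.Negation using (contradiction)
open import Relation.Binary.PropositionalEquality using (_≡_; refl; cong; subst; module ≡-Reasoning)

multiple-between-neighbours⇒≡ : ∀ {m c} b → m * b < c * b → c * b < (suc m + 1) * b → c ≡ suc m
multiple-between-neighbours⇒≡ {m} {c} b lo hi = ≤-antisym c≤1+m (*-cancelʳ-< b m c lo)
  where
  c≤1+m : c ≤ suc m
  c≤1+m = m<1+n⇒m≤n (subst (c <_) (+-comm (suc m) 1) (*-cancelʳ-< b c (suc m + 1) hi))

*-2^-suc-+ : ∀ p d e → p * 2 ^ (suc e + d) ≡ 2 * (p * 2 ^ d) * 2 ^ e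
*-2^-suc-+ p d e = begin
  p * (2 * 2 ^ (e + d))     ≡⟨ cong (λ t → p * (2 * t)) (^-distribˡ-+-* 2 e d) ⟩
  p * (2 * (2 ^ e * 2 ^ d)) ≡⟨ rearrange p (2 ^ e) (2 ^ d) ⟩
  2 * (p * 2 ^ d) * 2 ^ e   ∎
  where
  open ≡-Reasoning
  rearrange : ∀ p a b → p * (2 * (a * b)) ≡ 2 * (p * b) * a
  rearrange = solve-∀

odd-neighbourhood⇒exponent≤ : ∀ {q p e f} → Odd q →
  (q ∸ 1) * 2 ^ e < p * 2 ^ f → p * 2 ^ f < (q + 1) * 2 ^ e → f ≤ e
odd-neighbourhood⇒exponent≤ {p = p} {e} {f} (k , refl) lo hi with f ≤? e
... | yes f≤e = f≤e
... | no f≰e with m≤n⇒∃[o]m+o≡n (≰⇒> f≰e)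
... | d , refl = contradiction even≡odd (even≢odd (p * 2 ^ d) k)
  where
  even≡odd : 2 * (p * 2 ^ d) ≡ suc (2 * k)
  even≡odd = multiple-between-neighbours⇒≡ (2 ^ e)
    (subst (2 * k * 2 ^ e <_) (*-2^-suc-+ p d e) lo)
    (subst (_< (suc (2 * k) + 1) * 2 ^ e) (*-2^-suc-+ p d e) hi)

lemma4p7 : (x y z : ℕ) → 1 ≤ x → x < y → y ≤ z →
    (f₁ f₂ : ℕ) → IsF x y f₁ → IsF x z f₂ → f₁ ≤ f₂
lemma4p7 _ _ _ _ _ _ zero _ _ _ = z≤n
lemma4p7 _ _ _ _ _ _ (suc _) zero _ (_ , () , _)
lemma4p7 x y z _ _ y≤z (suc e₁) (suc e₂)
  (q₁ , _ , _ , _ , x≤q₁2^e₁ , q₁2^e₁<y , _) (q₂ , _ , odd-q₂ , below-x , _ , _ , z≤above) =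
  s≤s (odd-neighbourhood⇒exponent≤ {p = q₁} odd-q₂
    (<-≤-trans below-x x≤q₁2^e₁) (<-≤-trans q₁2^e₁<y (≤-trans y≤z z≤above)))
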